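{- Let $n_0(k)=\frac32+\sqrt{2k+\frac94}$. If $k\ge2$ and $0\le n\le n_0(k)$, then $[z^n]\,\mathcal L_k(z)\ge0$, where $$\mathcal L_k(z)=\widehat W_{k,C_3}(z)-\frac{b_k}{(1-T(z))^{3k}}+\frac{c'_k}{(1-T(z))^{3k-1}}.$$
   Context: $T(z)=\sum_{n\ge1}n^{n-1}z^n/n!$. $\widehat W_{k,C_3}(z)=\sum_ng_{n,k}z^n/n!$ with $g_{n,k}$ the number of connected triangle-free simple graphs on $\{1,\dots,n\}$ with $n+k$ edges. Wright's constants: $b_1=\frac5{24}$, $2(k+1)b_{k+1}=3k(k+1)b_k+3\sum_{t=1}^{k-1}t(k-t)b_tb_{k-t}$; $c_1=\frac{19}{24}$, $2(3k+2)c_{k+1}=8(k+1)b_{k+1}+3kb_k+(3k+2)(3k-1)c_k+6\sum_{t=1}^{k-1}t(3k-3t-1)b_tc_{k-t}$. $c'_1=\frac{25}{24}$, $c'_{k+1}=c_{k+1}+\frac32kb_k$. -}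

module Defs where

open import Data.Nat as ℕ using (ℕ; zero; suc; _+_; _*_; _∸_; _^_; _≤_; _<ᵇ_; _≡ᵇ_; _!)
open import Data.Nat.Properties using (_!≢0)
open import Data.Integer as ℤ using (ℤ; +_)
open import Data.Rational as ℚ using (ℚ; 0ℚ; 1ℚ)
open import Data.Bool using (Bool; true; false; _∧_; _∨_; not; if_then_else_)
open import Data.Fin using (Fin; toℕ) renaming (zero to fzero)
open import Data.List using (List; []; _∷_; _++_; map; concatMap; length; allFin; filterᵇ)
open import Data.Bool.ListAction using (any; all)
open import Data.Product using (_×_; _,_)

ι : ℕ → ℚ
ι n = (+ n) ℚ./ 1

Σ₁ : ℕ → (ℕ → ℚ) → ℚ
Σ₁ zero    f = 0ℚ
Σ₁ (suc m) f = Σ₁ m f ℚ.+ f (suc m)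

Σ₀ : ℕ → (ℕ → ℚ) → ℚ
Σ₀ zero    f = f 0
Σ₀ (suc m) f = Σ₀ m f ℚ.+ f (suc m)

-- Course-of-values recursion: `step n prev` computes the n-th value,
-- where `prev i` is the i-th value for every i < n.
private
  table : (ℕ → (ℕ → ℚ) → ℚ) → ℕ → (ℕ → ℚ)
  table step zero    = λ _ → 0ℚ
  table step (suc m) = λ i → if i <ᵇ m then table step m i else step m (table step m)

cov : (ℕ → (ℕ → ℚ) → ℚ) → ℕ → ℚ
cov step n = table step (suc n) n

-- Wright's constants b_k, c_k, c'_k  (k ≥ 1; value at k = 0 is a dummy 0)

bStep : ℕ → (ℕ → ℚ) → ℚ
bStep zero          b = 0ℚ
bStep (suc zero)    b = (+ 5) ℚ./ 24
-- b_{k+1} with k = suc j: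
-- 2(k+1) b_{k+1} = 3k(k+1) b_k + 3 Σ_{t=1}^{k-1} t(k-t) b_t b_{k-t}
bStep (suc (suc j)) b =
  ((ι (3 * k * (k + 1)) ℚ.* b k)
    ℚ.+ (ι 3 ℚ.* Σ₁ (k ∸ 1) (λ t → ι (t * (k ∸ t)) ℚ.* b t ℚ.* b (k ∸ t))))
  ℚ.* ((+ 1) ℚ./ (2 * (suc k)))
  where k = suc j

b : ℕ → ℚ
b = cov bStep

cStep : ℕ → (ℕ → ℚ) → ℚ
cStep zero          c = 0ℚ
cStep (suc zero)    c = (+ 19) ℚ./ 24
-- c_{k+1} with k = suc j:
-- 2(3k+2) c_{k+1} = 8(k+1) b_{k+1} + 3k b_k + (3k+2)(3k-1) c_k
--                   + 6 Σ_{t=1}^{k-1} t(3k-3t-1) b_t c_{k-t}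
cStep (suc (suc j)) c =
  (ι (8 * (k + 1)) ℚ.* b (k + 1)
    ℚ.+ ι (3 * k) ℚ.* b k
    ℚ.+ ι ((3 * k + 2) * (3 * k ∸ 1)) ℚ.* c k
    ℚ.+ ι 6 ℚ.* Σ₁ (k ∸ 1) (λ t → ι (t * (3 * k ∸ 3 * t ∸ 1)) ℚ.* b t ℚ.* c (k ∸ t)))
  ℚ.* ((+ 1) ℚ./ (2 * (3 * k + 2)))
  where k = suc j

c : ℕ → ℚ
c = cov cStep

c′ : ℕ → ℚ
c′ zero          = 0ℚ
c′ (suc zero)    = (+ 25) ℚ./ 24
c′ (suc (suc j)) = c (suc (suc j)) ℚ.+ ((+ 3) ℚ./ 2) ℚ.* ι (suc j) ℚ.* b (suc j)

PS : Set
PS = ℕ → ℚ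

_⊛_ : PS → PS → PS
(f ⊛ g) n = Σ₀ n (λ i → f i ℚ.* g (n ∸ i))

oneS : PS
oneS zero    = 1ℚ
oneS (suc _) = 0ℚ

_^ˢ_ : PS → ℕ → PS
f ^ˢ zero  = oneS
f ^ˢ suc m = f ⊛ (f ^ˢ m)

-- multiplicative inverse of a series with constant term 1:
-- r_0 = 1, r_n = - Σ_{i=1}^n f_i r_{n-i}
inv₁ : PS → PS
inv₁ f = cov step
  where
  step : ℕ → (ℕ → ℚ) → ℚ
  step zero    r = 1ℚ
  step (suc m) r = ℚ.- Σ₁ (suc m) (λ i → f i ℚ.* r (suc m ∸ i))

Tser : PS
Tser zero    = 0ℚ
Tser (suc m) = ℚ._/_ (+ (suc m ^ m)) ((suc m) !) {{suc m !≢0}}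

oneMinusT : PS
oneMinusT n = oneS n ℚ.- Tser n

invPow : ℕ → PS
invPow m = inv₁ oneMinusT ^ˢ m

-- Labelled graphs on {0,…,n-1}: a graph is a set of edges, i.e. a subset
-- of the pairs (i , j) with i < j.

pairs : (n : ℕ) → List (Fin n × Fin n)
pairs n = concatMap (λ i → concatMap (λ j → if toℕ i <ᵇ toℕ j then (i , j) ∷ [] else [])
                                       (allFin n)) (allFin n)

bitLists : ℕ → List (List Bool)
bitLists zero    = [] ∷ []
bitLists (suc m) = map (true ∷_) (bitLists m) ++ map (false ∷_) (bitLists m)

select : {A : Set} → List A → List Bool → List A
select []       _              = []
select (_ ∷ _)  []             = []
select (x ∷ xs) (true  ∷ bs)   = x ∷ select xs bs
select (x ∷ xs) (false ∷ bs)   = select xs bs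

allGraphs : (n : ℕ) → List (List (Fin n × Fin n))
allGraphs n = map (select (pairs n)) (bitLists (length (pairs n)))

_=ᶠ_ : {n : ℕ} → Fin n → Fin n → Bool
i =ᶠ j = toℕ i ≡ᵇ toℕ j

adj : {n : ℕ} → List (Fin n × Fin n) → Fin n → Fin n → Bool
adj es u v = any (λ { (i , j) → (i =ᶠ u ∧ j =ᶠ v) ∨ (i =ᶠ v ∧ j =ᶠ u) }) es

-- no three vertices pairwise adjacent (adjacency is irreflexive)
triangleFree : {n : ℕ} → List (Fin n × Fin n) → Bool
triangleFree {n} es =
  all (λ u → all (λ v → all (λ w → not (adj es u v ∧ adj es v w ∧ adj es u w))
    (allFin n)) (allFin n)) (allFin n)

reach : {n : ℕ} → List (Fin n × Fin n) → ℕ → Fin n → Fin n → Bool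
reach es zero    u v = u =ᶠ v
reach {n} es (suc s) u v = reach es s u v ∨ any (λ w → reach es s u w ∧ adj es w v) (allFin n)

-- connected: every vertex is joined to vertex 0 by a walk (length ≤ n suffices)
connected : {n : ℕ} → List (Fin n × Fin n) → Bool
connected {zero}  es = true
connected {suc m} es = all (λ v → reach es (suc m) fzero v) (allFin (suc m))

g : ℕ → ℕ → ℕ
g n k = length (filterᵇ (λ es → (length es ≡ᵇ n + k) ∧ triangleFree es ∧ connected es)
                        (allGraphs n))

Wser : ℕ → PS
Wser k n = ℚ._/_ (+ g n k) (n !) {{n !≢0}}

Lser : ℕ → PS
Lser k n = (Wser k n ℚ.- b k ℚ.* invPow (3 * k) n) ℚ.+ c′ k ℚ.* invPow (3 * k ∸ 1) n

-- n ≤ n₀(k) = 3/2 + √(2k + 9/4), i.e. 2n − 3 ≤ √(8k + 9).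
-- (If 2n < 3 this holds trivially, and the truncated 2n ∸ 3 = 0 also makes it hold.)
BelowN₀ : ℕ → ℕ → Set
BelowN₀ k n = (2 * n ∸ 3) ^ 2 ≤ 8 * k + 9

{-# OPTIONS --safe #-}
-- Since Ŵ has nonnegative coefficients, it suffices to show
-- b_k [zⁿ] (1-T)^{-3k} ≤ c′_k [zⁿ] (1-T)^{-(3k-1)}.  For k = 2 the hypothesis leaves
-- n ≤ 4 and this is a finite computation.  For k ≥ 3 two estimates combine.  Wright's
-- recurrences give c_k ≥ (19/5) b_k by induction on k, and c′_k ≥ c_k.  The coefficients
-- a_{M,n} of (1-T)^{-M} satisfy M a_{M,n-1} ≤ n a_{M,n}, so n ≤ θ M gives
-- a_{M,n-j} ≤ θ^j a_{M,n}, and then a_{M+1,n} = Σ_j r_j a_{M,n-j} ≤ (Σ_{j≤n} r_j θ^j) a_{M,n}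
-- with r = 1/(1-T).  The hypothesis n ≤ n₀(k) means n (n - 3) ≤ 2k, which allows
-- θ = 1/2, 5/14, 1/7 for n ≤ 4, 5 ≤ n ≤ 7, n ≥ 8 respectively; the resulting sums are at
-- most 19/5, by computation in the first two cases and by r_j ≤ 5^j in the last.
module Submission where

open import Defs
open import Data.Nat using (ℕ; _≤_)
open import Data.Rational using (0ℚ) renaming (_≤_ to _≤ℚ_)

open import Data.Bool using (false; true; if_then_else_)
open import Data.Empty using (⊥-elim)
open import Data.Nat as ℕ using (zero; suc; z≤n; s≤s; _<_; _<ᵇ_; _!; NonZero; ⌊_/2⌋; ⌈_/2⌉)
import Data.Nat.Properties as ℕP
open import Data.Nat.Induction using (<-rec)
open import Data.Product using (Σ; _,_; proj₁; proj₂)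
open import Data.Sum using (inj₁; inj₂)
open import Data.Unit using (tt)
open import Relation.Nullary using (yes; no)
open import Relation.Binary.PropositionalEquality
  using (_≡_; refl; sym; trans; cong; cong₂; subst; subst₂; module ≡-Reasoning)

module _ where
  open import Data.Nat using (_+_; _*_; _∸_; _^_)
  open import Data.Nat.Solver using (module +-*-Solver)
  open +-*-Solver
  open ℕP.≤-Reasoning

  2t[k∸t]≤t[3k∸3t∸1] : ∀ {t k} → t < k → 2 * (t * (k ∸ t)) ≤ t * (3 * k ∸ 3 * t ∸ 1)
  2t[k∸t]≤t[3k∸3t∸1] {t} {k} t<k = subst (λ e → 2 * (t * (k ∸ t)) ≤ t * (e ∸ 1))
    (ℕP.*-distribˡ-∸ 3 k t) (2ts≤t[3s∸1] (k ∸ t) (ℕP.m<n⇒0<n∸m t<k))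
    where
    2ts≤t[3s∸1] : ∀ s → 1 ≤ s → 2 * (t * s) ≤ t * (3 * s ∸ 1)
    2ts≤t[3s∸1] (suc s) _ = begin
      2 * (t * suc s)
        ≡⟨ solve 2 (λ t s → con 2 :* (t :* (con 1 :+ s)) := t :* (con 2 :* (con 1 :+ s))) refl t s ⟩
      t * (2 * suc s)
        ≤⟨ ℕP.*-monoʳ-≤ t (ℕP.m≤n+m (2 * suc s) s) ⟩
      t * (3 * suc s ∸ 1) ∎

  [1+i]^j*[i∸j]≤i^[1+j] : ∀ i j → j ≤ i → suc i ^ j * (i ∸ j) ≤ i ^ suc j
  [1+i]^j*[i∸j]≤i^[1+j] i zero    _   = ℕP.≤-reflexive (ℕP.*-comm 1 i)
  [1+i]^j*[i∸j]≤i^[1+j] i (suc j) j<i = ℕP.*-cancelʳ-≤ _ _ (suc d) (begin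
    suc i ^ suc j * d * suc d
      ≡⟨ solve 3 (λ p d i → (con 1 :+ i) :* p :* d :* (con 1 :+ d) := (p :* (con 1 :+ d)) :* ((con 1 :+ i) :* d))
           refl P d i ⟩
    P * suc d * (suc i * d)
      ≤⟨ ℕP.*-mono-≤ P[1+d]≤Q [1+i]d≤i[1+d] ⟩
    Q * (i * suc d)
      ≡⟨ solve 3 (λ q d i → q :* (i :* (con 1 :+ d)) := i :* q :* (con 1 :+ d)) refl Q d i ⟩
    i ^ suc (suc j) * suc d ∎)
    where
    d = i ∸ suc j
    P = suc i ^ j
    Q = i ^ suc j
    P[1+d]≤Q : P * suc d ≤ Q
    P[1+d]≤Q = subst (λ e → P * e ≤ Q) (ℕP.+-∸-assoc 1 j<i) ([1+i]^j*[i∸j]≤i^[1+j] i j (ℕP.<⇒≤ j<i))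
    [1+i]d≤i[1+d] : suc i * d ≤ i * suc d
    [1+i]d≤i[1+d] = subst (suc i * d ≤_) (sym (ℕP.*-suc i d)) (ℕP.+-monoˡ-≤ (i * d) (ℕP.m∸n≤m i (suc j)))

  [1+i]^j≤2*i^j : ∀ i j → 2 * j ≤ i → suc i ^ j ≤ 2 * i ^ j
  [1+i]^j≤2*i^j zero    zero _   = s≤s z≤n
  [1+i]^j≤2*i^j (suc i) j  2j≤i = ℕP.*-cancelʳ-≤ _ _ (suc i) (begin
    suc I ^ j * I
      ≤⟨ ℕP.*-monoʳ-≤ (suc I ^ j) I≤2[I∸j] ⟩
    suc I ^ j * (2 * (I ∸ j))
      ≡⟨ solve 2 (λ p e → p :* (con 2 :* e) := con 2 :* (p :* e)) refl (suc I ^ j) (I ∸ j) ⟩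
    2 * (suc I ^ j * (I ∸ j))
      ≤⟨ ℕP.*-monoʳ-≤ 2 ([1+i]^j*[i∸j]≤i^[1+j] I j j≤I) ⟩
    2 * (I * I ^ j)
      ≡⟨ solve 2 (λ q i → con 2 :* (i :* q) := con 2 :* q :* i) refl (I ^ j) I ⟩
    2 * I ^ j * I ∎)
    where
    I = suc i
    j≤I : j ≤ I
    j≤I = ℕP.≤-trans (ℕP.m≤m+n j (j + 0)) 2j≤i
    I≤2[I∸j] : I ≤ 2 * (I ∸ j)
    I≤2[I∸j] = subst (I ≤_) (sym (ℕP.*-distribˡ-∸ 2 I j)) (ℕP.m+n≤o⇒m≤o∸n I (begin
      I + 2 * j  ≤⟨ ℕP.+-monoʳ-≤ I 2j≤i ⟩
      I + I      ≡⟨ solve 1 (λ x → x :+ x := con 2 :* x) refl I ⟩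
      2 * I      ∎))

  2*⌊n/2⌋≤n : ∀ n → 2 * ⌊ n /2⌋ ≤ n
  2*⌊n/2⌋≤n n = begin
    ⌊ n /2⌋ + (⌊ n /2⌋ + 0)   ≡⟨ cong (⌊ n /2⌋ +_) (ℕP.+-identityʳ ⌊ n /2⌋) ⟩
    ⌊ n /2⌋ + ⌊ n /2⌋         ≤⟨ ℕP.+-monoʳ-≤ ⌊ n /2⌋ (ℕP.⌊n/2⌋≤⌈n/2⌉ n) ⟩
    ⌊ n /2⌋ + ⌈ n /2⌉         ≡⟨ ℕP.⌊n/2⌋+⌈n/2⌉≡n n ⟩
    n                         ∎

  -- Each half of m contributes a factor (1 + 1/n)^{m/2} ≤ 2.
  [1+n]^m≤4*n^m : ∀ n m → m < n → suc n ^ m ≤ 4 * n ^ m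
  [1+n]^m≤4*n^m n m m<n = begin
    suc n ^ m
      ≡⟨ cong (suc n ^_) (sym (ℕP.⌊n/2⌋+⌈n/2⌉≡n m)) ⟩
    suc n ^ (h + h′)
      ≡⟨ ℕP.^-distribˡ-+-* (suc n) h h′ ⟩
    suc n ^ h * suc n ^ h′
      ≤⟨ ℕP.*-mono-≤ ([1+i]^j≤2*i^j n h 2h≤n) ([1+i]^j≤2*i^j n h′ 2h′≤n) ⟩
    2 * n ^ h * (2 * n ^ h′)
      ≡⟨ solve 2 (λ x y → (con 2 :* x) :* (con 2 :* y) := con 4 :* (x :* y)) refl (n ^ h) (n ^ h′) ⟩
    4 * (n ^ h * n ^ h′)
      ≡⟨ cong (4 *_) (sym (ℕP.^-distribˡ-+-* n h h′)) ⟩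
    4 * n ^ (h + h′)
      ≡⟨ cong (λ e → 4 * n ^ e) (ℕP.⌊n/2⌋+⌈n/2⌉≡n m) ⟩
    4 * n ^ m ∎
    where
    h  = ⌊ m /2⌋
    h′ = ⌈ m /2⌉
    2h≤n : 2 * h ≤ n
    2h≤n = ℕP.≤-trans (2*⌊n/2⌋≤n m) (ℕP.<⇒≤ m<n)
    2h′≤n : 2 * h′ ≤ n
    2h′≤n = ℕP.≤-trans (2*⌊n/2⌋≤n (suc m)) m<n

  [1+m]^m≤4^m*[1+m]! : ∀ m → suc m ^ m ≤ 4 ^ m * suc m !
  [1+m]^m≤4^m*[1+m]! zero    = s≤s z≤n
  [1+m]^m≤4^m*[1+m]! (suc m) = begin
    suc (suc m) * suc (suc m) ^ m
      ≤⟨ ℕP.*-monoʳ-≤ (suc (suc m)) ([1+n]^m≤4*n^m (suc m) m ℕP.≤-refl) ⟩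
    suc (suc m) * (4 * suc m ^ m)
      ≤⟨ ℕP.*-monoʳ-≤ (suc (suc m)) (ℕP.*-monoʳ-≤ 4 ([1+m]^m≤4^m*[1+m]! m)) ⟩
    suc (suc m) * (4 * (4 ^ m * suc m !))
      ≡⟨ solve 3 (λ x p f → (con 2 :+ x) :* (con 4 :* (p :* f)) := (con 4 :* p) :* ((con 2 :+ x) :* f))
           refl m (4 ^ m) (suc m !) ⟩
    4 ^ suc m * suc (suc m) ! ∎

  BelowN₀⇒n[n∸3]≤2k : ∀ k n → BelowN₀ k n → n * (n ∸ 3) ≤ 2 * k
  BelowN₀⇒n[n∸3]≤2k k 0 _ = z≤n
  BelowN₀⇒n[n∸3]≤2k k 1 _ = z≤n
  BelowN₀⇒n[n∸3]≤2k k 2 _ = z≤n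
  BelowN₀⇒n[n∸3]≤2k k n@(suc (suc (suc m))) hb = ℕP.*-cancelˡ-≤ 4 (ℕP.+-cancelʳ-≤ 9 _ _ (begin
    4 * (n * m) + 9      ≡⟨ sym [2n∸3]²≡ ⟩
    (2 * n ∸ 3) ^ 2      ≤⟨ hb ⟩
    8 * k + 9            ≡⟨ cong (_+ 9) (ℕP.*-assoc 4 2 k) ⟩
    4 * (2 * k) + 9      ∎))
    where
    [2n∸3]²≡ : (2 * n ∸ 3) ^ 2 ≡ 4 * (n * m) + 9
    [2n∸3]²≡ = trans
      (cong (λ e → (e ∸ 3) ^ 2) (solve 1 (λ m → con 2 :* (con 3 :+ m) := con 3 :+ (con 3 :+ con 2 :* m)) refl m))
      (solve 1 (λ m → (con 3 :+ con 2 :* m) :^ 2 := con 4 :* ((con 3 :+ m) :* m) :+ con 9) refl m)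

  private
    2[a+c]≤e[2k]⇒a≤ek∸c : ∀ a c e k → 2 * (a + c) ≤ e * (2 * k) → a ≤ e * k ∸ c
    2[a+c]≤e[2k]⇒a≤ek∸c a c e k h = ℕP.m+n≤o⇒m≤o∸n a (ℕP.*-cancelˡ-≤ 2
      (subst (2 * (a + c) ≤_) (solve 2 (λ e k → e :* (con 2 :* k) := con 2 :* (e :* k)) refl e k) h))

  n≤4⇒2n≤3k∸1 : ∀ {k n} → 3 ≤ k → n ≤ 4 → 2 * n ≤ 1 * (3 * k ∸ 1)
  n≤4⇒2n≤3k∸1 {k} {n} 3≤k n≤4 = begin
    2 * n                 ≤⟨ ℕP.*-monoʳ-≤ 2 n≤4 ⟩
    3 * 3 ∸ 1             ≤⟨ ℕP.∸-monoˡ-≤ 1 (ℕP.*-monoʳ-≤ 3 3≤k) ⟩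
    3 * k ∸ 1             ≡⟨ sym (ℕP.*-identityˡ (3 * k ∸ 1)) ⟩
    1 * (3 * k ∸ 1)       ∎

  5≤n⇒14n≤5[3k∸1] : ∀ {k n} → 5 ≤ n → n * (n ∸ 3) ≤ 2 * k → 14 * n ≤ 5 * (3 * k ∸ 1)
  5≤n⇒14n≤5[3k∸1] {k} (s≤s (s≤s (s≤s (s≤s (s≤s {n = m} _))))) n[n∸3]≤2k = begin
    14 * n           ≤⟨ 2[a+c]≤e[2k]⇒a≤ek∸c (14 * n) 5 15 k (ℕP.≤-trans quadratic (ℕP.*-monoʳ-≤ 15 n[n∸3]≤2k)) ⟩
    15 * k ∸ 5       ≡⟨ cong (_∸ 5) (ℕP.*-assoc 5 3 k) ⟩
    5 * (3 * k) ∸ 5  ≡⟨ sym (ℕP.*-distribˡ-∸ 5 (3 * k) 1) ⟩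
    5 * (3 * k ∸ 1)  ∎
    where
    n = 5 + m
    quadratic : 2 * (14 * n + 5) ≤ 15 * (n * (n ∸ 3))
    quadratic = begin
      2 * (14 * n + 5)
        ≤⟨ ℕP.m≤m+n _ _ ⟩
      2 * (14 * n + 5) + m * (77 + 15 * m)
        ≡⟨ solve 1 (λ m → con 2 :* (con 14 :* (con 5 :+ m) :+ con 5) :+ m :* (con 77 :+ con 15 :* m)
                          := con 15 :* ((con 5 :+ m) :* (con 2 :+ m))) refl m ⟩
      15 * (n * (n ∸ 3)) ∎

  8≤n⇒7n≤3k∸1 : ∀ {k n} → 8 ≤ n → n * (n ∸ 3) ≤ 2 * k → 7 * n ≤ 1 * (3 * k ∸ 1)
  8≤n⇒7n≤3k∸1 {k} (s≤s (s≤s (s≤s (s≤s (s≤s (s≤s (s≤s (s≤s {n = m} _)))))))) n[n∸3]≤2k = begin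
    7 * n              ≤⟨ 2[a+c]≤e[2k]⇒a≤ek∸c (7 * n) 1 3 k (ℕP.≤-trans quadratic (ℕP.*-monoʳ-≤ 3 n[n∸3]≤2k)) ⟩
    3 * k ∸ 1          ≡⟨ sym (ℕP.*-identityˡ (3 * k ∸ 1)) ⟩
    1 * (3 * k ∸ 1)    ∎
    where
    n = 8 + m
    quadratic : 2 * (7 * n + 1) ≤ 3 * (n * (n ∸ 3))
    quadratic = begin
      2 * (7 * n + 1)
        ≤⟨ ℕP.m≤m+n _ _ ⟩
      2 * (7 * n + 1) + (6 + m * (25 + 3 * m))
        ≡⟨ solve 1 (λ m → con 2 :* (con 7 :* (con 8 :+ m) :+ con 1) :+ (con 6 :+ m :* (con 25 :+ con 3 :* m))
                          := con 3 :* ((con 8 :+ m) :* (con 5 :+ m))) refl m ⟩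
      3 * (n * (n ∸ 3)) ∎

  BelowN₀-2⇒n≤4 : ∀ n → BelowN₀ 2 n → n ≤ 4
  BelowN₀-2⇒n≤4 n hb with n ℕ.≤? 4
  ... | yes n≤4 = n≤4
  ... | no  n≰4 = ⊥-elim (ℕP.<⇒≱ (ℕP.≤ᵇ⇒≤ 5 10 tt) (begin
    10             ≤⟨ ℕP.*-mono-≤ (ℕP.≰⇒> n≰4) (ℕP.∸-monoˡ-≤ 3 (ℕP.≰⇒> n≰4)) ⟩
    n * (n ∸ 3)    ≤⟨ BelowN₀⇒n[n∸3]≤2k 2 n hb ⟩
    4              ∎))

open import Algebra.Bundles using (CommutativeRing)
open import Data.Integer as ℤ using (+_)
import Data.Integer.Properties as ℤP
open import Data.Nat.Coprimality using (1-coprimeTo) renaming (sym to coprime-sym)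
open import Data.Rational as ℚ using (ℚ; 1ℚ; mkℚ; _+_; _*_; _-_; -_; _/_; Positive)
import Data.Rational.Properties as ℚP
open import Data.Rational.Solver using (module +-*-Solver)
import Data.Rational.Unnormalised as ℚᵘ
import Data.Rational.Unnormalised.Properties as ℚᵘP
open import Algebra.Properties.CommutativeSemiring.Exp
  (CommutativeRing.commutativeSemiring ℚP.+-*-commutativeRing) using (_^_; ^-distrib-*)

open +-*-Solver using (solve; _:=_; _:+_; _:*_; _:-_; :-_; con)

private
  ι-mkℚ : ∀ n → ι n ≡ mkℚ (+ n) 0 (coprime-sym (1-coprimeTo n))
  ι-mkℚ n = ℚP.normalize-coprime (coprime-sym (1-coprimeTo n))

  ι-1+ : ∀ n → ι (suc n) ≡ 1ℚ + ι n
  ι-1+ n rewrite ι-mkℚ n = cong (_/ 1) (sym (cong (λ z → (+ 1) ℤ.+ z) (ℤP.*-identityʳ (+ n))))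

ι-+ : ∀ m n → ι (m ℕ.+ n) ≡ ι m + ι n
ι-+ zero    n = sym (ℚP.+-identityˡ (ι n))
ι-+ (suc m) n = begin
  ι (suc (m ℕ.+ n))    ≡⟨ ι-1+ (m ℕ.+ n) ⟩
  1ℚ + ι (m ℕ.+ n)     ≡⟨ cong (λ x → 1ℚ + x) (ι-+ m n) ⟩
  1ℚ + (ι m + ι n)     ≡⟨ sym (ℚP.+-assoc 1ℚ (ι m) (ι n)) ⟩
  (1ℚ + ι m) + ι n     ≡⟨ cong (_+ ι n) (sym (ι-1+ m)) ⟩
  ι (suc m) + ι n      ∎
  where open ≡-Reasoning

ι-suc : ∀ n → ι (suc n) ≡ ι n + 1ℚ
ι-suc n = trans (cong ι (ℕP.+-comm 1 n)) (ι-+ n 1)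

ι-* : ∀ m n → ι (m ℕ.* n) ≡ ι m * ι n
ι-* zero    n = sym (ℚP.*-zeroˡ (ι n))
ι-* (suc m) n = begin
  ι (n ℕ.+ m ℕ.* n)    ≡⟨ ι-+ n (m ℕ.* n) ⟩
  ι n + ι (m ℕ.* n)    ≡⟨ cong (λ x → ι n + x) (ι-* m n) ⟩
  ι n + ι m * ι n      ≡⟨ solve 2 (λ x y → y :+ x :* y := (con 1ℚ :+ x) :* y) refl (ι m) (ι n) ⟩
  (1ℚ + ι m) * ι n     ≡⟨ cong (_* ι n) (sym (ι-1+ m)) ⟩
  ι (suc m) * ι n      ∎
  where open ≡-Reasoning

ι-∸ : ∀ {m n} → n ≤ m → ι (m ℕ.∸ n) ≡ ι m - ι n
ι-∸ {m} {n} n≤m = begin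
  ι (m ℕ.∸ n)                ≡⟨ solve 2 (λ x y → x := (x :+ y) :- y) refl (ι (m ℕ.∸ n)) (ι n) ⟩
  (ι (m ℕ.∸ n) + ι n) - ι n  ≡⟨ cong (_- ι n) (trans (sym (ι-+ (m ℕ.∸ n) n)) (cong ι (ℕP.m∸n+n≡m n≤m))) ⟩
  ι m - ι n                  ∎
  where open ≡-Reasoning

ι-^ : ∀ m n → ι (m ℕ.^ n) ≡ ι m ^ n
ι-^ m zero    = refl
ι-^ m (suc n) = trans (ι-* m (m ℕ.^ n)) (cong (ι m *_) (ι-^ m n))

ι-nonNeg : ∀ n → 0ℚ ≤ℚ ι n
ι-nonNeg n = ℚP.nonNegative⁻¹ (ι n) {{ℚP.normalize-nonNeg n 1}}

ι-pos : ∀ n → Positive (ι (suc n))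
ι-pos n = ℚP.normalize-pos (suc n) 1

/-nonNeg : ∀ n d .{{_ : NonZero d}} → 0ℚ ≤ℚ (+ n) / d
/-nonNeg n d = ℚP.nonNegative⁻¹ _ {{ℚP.normalize-nonNeg n d}}

ι-cancel-/ : ∀ d .{{_ : NonZero d}} x → ι d * (x * ((+ 1) / d)) ≡ x
ι-cancel-/ (suc d) x = begin
  ι (suc d) * (x * u)  ≡⟨ solve 3 (λ a e v → a :* (e :* v) := e :* (v :* a)) refl (ι (suc d)) x u ⟩
  x * (u * ι (suc d))  ≡⟨ cong (x *_) u*ι≡1 ⟩
  x * 1ℚ               ≡⟨ ℚP.*-identityʳ x ⟩
  x                    ∎
  where
  open ≡-Reasoning
  u = (+ 1) / suc d
  u*ι≡1 : u * ι (suc d) ≡ 1ℚ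
  u*ι≡1 = trans (cong₂ _*_ (ℚP.normalize-coprime {1} {d} (1-coprimeTo (suc d))) (ι-mkℚ (suc d)))
                (ℚP.*-inverseˡ (mkℚ (+ suc d) 0 (coprime-sym (1-coprimeTo (suc d)))))

-- The rational p/d, in the shape on which ι-cancel-/ acts.
_//_ : ℕ → (d : ℕ) → .{{NonZero d}} → ℚ
p // d = ι p * ((+ 1) / d)

+-nonNeg : ∀ {p q} → 0ℚ ≤ℚ p → 0ℚ ≤ℚ q → 0ℚ ≤ℚ p + q
+-nonNeg = ℚP.+-mono-≤

*-nonNeg : ∀ {p q} → 0ℚ ≤ℚ p → 0ℚ ≤ℚ q → 0ℚ ≤ℚ p * q
*-nonNeg {p} {q} 0≤p 0≤q =
  ℚP.nonNegative⁻¹ _ {{ℚP.nonNeg*nonNeg⇒nonNeg p {{ℚ.nonNegative 0≤p}} q {{ℚ.nonNegative 0≤q}}}}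

*-monoˡ-≤-0≤ : ∀ {r p q} → 0ℚ ≤ℚ r → p ≤ℚ q → r * p ≤ℚ r * q
*-monoˡ-≤-0≤ {r} 0≤r = ℚP.*-monoˡ-≤-nonNeg r {{ℚ.nonNegative 0≤r}}

*-monoʳ-≤-0≤ : ∀ {r p q} → 0ℚ ≤ℚ r → p ≤ℚ q → p * r ≤ℚ q * r
*-monoʳ-≤-0≤ {r} 0≤r = ℚP.*-monoʳ-≤-nonNeg r {{ℚ.nonNegative 0≤r}}

*-mono-≤-0≤ : ∀ {p q r s} → 0ℚ ≤ℚ q → 0ℚ ≤ℚ r → p ≤ℚ q → r ≤ℚ s → p * r ≤ℚ q * s
*-mono-≤-0≤ 0≤q 0≤r p≤q r≤s = ℚP.≤-trans (*-monoʳ-≤-0≤ 0≤r p≤q) (*-monoˡ-≤-0≤ 0≤q r≤s)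

^-nonNeg : ∀ {x} → 0ℚ ≤ℚ x → ∀ n → 0ℚ ≤ℚ x ^ n
^-nonNeg 0≤x zero    = ℚP.≤ᵇ⇒≤ tt
^-nonNeg 0≤x (suc n) = *-nonNeg 0≤x (^-nonNeg 0≤x n)

p≤p+q : ∀ {p q} → 0ℚ ≤ℚ q → p ≤ℚ p + q
p≤p+q {p} {q} 0≤q = subst (_≤ℚ p + q) (ℚP.+-identityʳ p) (ℚP.+-monoʳ-≤ p 0≤q)

p≤q⇒0≤q-p : ∀ {p q} → p ≤ℚ q → 0ℚ ≤ℚ q - p
p≤q⇒0≤q-p {p} {q} p≤q = subst (_≤ℚ q - p) (ℚP.+-inverseʳ p) (ℚP.+-monoˡ-≤ (- p) p≤q)

0≤q-p⇒p≤q : ∀ {p q} → 0ℚ ≤ℚ q - p → p ≤ℚ q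
0≤q-p⇒p≤q {p} {q} 0≤q-p =
  subst₂ _≤ℚ_ (ℚP.+-identityˡ p) (solve 2 (λ x y → (y :- x) :+ x := y) refl p q) (ℚP.+-monoˡ-≤ p 0≤q-p)

ι-mono-≤ : ∀ {m n} → m ≤ n → ι m ≤ℚ ι n
ι-mono-≤ {m} {n} m≤n = subst (ι m ≤ℚ_) ι-n (p≤p+q (ι-nonNeg (n ℕ.∸ m)))
  where
  ι-n : ι m + ι (n ℕ.∸ m) ≡ ι n
  ι-n = trans (sym (ι-+ m (n ℕ.∸ m))) (cong ι (ℕP.m+[n∸m]≡n m≤n))

//-nonNeg : ∀ p d .{{_ : NonZero d}} → 0ℚ ≤ℚ p // d
//-nonNeg p d = *-nonNeg (ι-nonNeg p) (/-nonNeg 1 d)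

ι≤//*ι : ∀ {n m} p d .{{_ : NonZero d}} → d ℕ.* n ≤ p ℕ.* m → ι n ≤ℚ (p // d) * ι m
ι≤//*ι {n} {m} p (suc d) dn≤pm = ℚP.*-cancelˡ-≤-pos (ι (suc d)) {{ι-pos d}}
  (subst₂ _≤ℚ_ (ι-* (suc d) n) ι-pm (ι-mono-≤ dn≤pm))
  where
  ι-pm : ι (p ℕ.* m) ≡ ι (suc d) * ((p // suc d) * ι m)
  ι-pm = trans (ι-* p m) (sym (trans
    (solve 4 (λ s a u b → s :* ((a :* u) :* b) := s :* ((a :* b) :* u)) refl
       (ι (suc d)) (ι p) ((+ 1) / suc d) (ι m))
    (ι-cancel-/ (suc d) (ι p * ι m))))

n/d≤m/e : ∀ n d m e .{{_ : NonZero d}} .{{_ : NonZero e}} → n ℕ.* e ≤ m ℕ.* d → (+ n) / d ≤ℚ (+ m) / e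
n/d≤m/e n (suc d) m (suc e) ne≤md = ℚP.toℚᵘ-cancel-≤
  (ℚᵘP.≤-respʳ-≃ (ℚᵘP.≃-sym (ℚP.toℚᵘ-fromℚᵘ (ℚᵘ.mkℚᵘ (+ m) e)))
    (ℚᵘP.≤-respˡ-≃ (ℚᵘP.≃-sym (ℚP.toℚᵘ-fromℚᵘ (ℚᵘ.mkℚᵘ (+ n) d)))
      (ℚᵘ.*≤* (subst₂ ℤ._≤_ (ℤP.pos-* n (suc e)) (ℤP.pos-* m (suc d)) (ℤ.+≤+ ne≤md)))))

Σ₁-cong : ∀ m {f g : ℕ → ℚ} → (∀ t → 1 ≤ t → t ≤ m → f t ≡ g t) → Σ₁ m f ≡ Σ₁ m g
Σ₁-cong zero    f≡g = refl
Σ₁-cong (suc m) f≡g =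
  cong₂ _+_ (Σ₁-cong m λ t 1≤t t≤m → f≡g t 1≤t (ℕP.m≤n⇒m≤1+n t≤m)) (f≡g (suc m) (s≤s z≤n) ℕP.≤-refl)

Σ₁-mono-≤ : ∀ m {f g : ℕ → ℚ} → (∀ t → 1 ≤ t → t ≤ m → f t ≤ℚ g t) → Σ₁ m f ≤ℚ Σ₁ m g
Σ₁-mono-≤ zero    f≤g = ℚP.≤-refl
Σ₁-mono-≤ (suc m) f≤g =
  ℚP.+-mono-≤ (Σ₁-mono-≤ m λ t 1≤t t≤m → f≤g t 1≤t (ℕP.m≤n⇒m≤1+n t≤m)) (f≤g (suc m) (s≤s z≤n) ℕP.≤-refl)

Σ₁-nonNeg : ∀ m {f : ℕ → ℚ} → (∀ t → 1 ≤ t → t ≤ m → 0ℚ ≤ℚ f t) → 0ℚ ≤ℚ Σ₁ m f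
Σ₁-nonNeg zero    0≤f = ℚP.≤-refl
Σ₁-nonNeg (suc m) 0≤f =
  +-nonNeg (Σ₁-nonNeg m λ t 1≤t t≤m → 0≤f t 1≤t (ℕP.m≤n⇒m≤1+n t≤m)) (0≤f (suc m) (s≤s z≤n) ℕP.≤-refl)

Σ₁-distribˡ : ∀ m a (f : ℕ → ℚ) → Σ₁ m (λ t → a * f t) ≡ a * Σ₁ m f
Σ₁-distribˡ zero    a f = sym (ℚP.*-zeroʳ a)
Σ₁-distribˡ (suc m) a f =
  trans (cong (_+ a * f (suc m)) (Σ₁-distribˡ m a f)) (sym (ℚP.*-distribˡ-+ a (Σ₁ m f) (f (suc m))))

Σ₁-neg : ∀ m (f : ℕ → ℚ) → Σ₁ m (λ t → - f t) ≡ - Σ₁ m f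
Σ₁-neg zero    f = refl
Σ₁-neg (suc m) f = trans (cong (_+ - f (suc m)) (Σ₁-neg m f)) (sym (ℚP.neg-distrib-+ (Σ₁ m f) (f (suc m))))

Σ₁-head-≤ : ∀ m {f : ℕ → ℚ} → (∀ t → 1 ≤ t → t ≤ suc m → 0ℚ ≤ℚ f t) → f 1 ≤ℚ Σ₁ (suc m) f
Σ₁-head-≤ zero    {f} 0≤f = ℚP.≤-reflexive (sym (ℚP.+-identityˡ (f 1)))
Σ₁-head-≤ (suc m) {f} 0≤f = ℚP.≤-trans
  (Σ₁-head-≤ m λ t 1≤t t≤m → 0≤f t 1≤t (ℕP.m≤n⇒m≤1+n t≤m)) (p≤p+q (0≤f (suc (suc m)) (s≤s z≤n) ℕP.≤-refl))

Σ₀-cong : ∀ n {f g : ℕ → ℚ} → (∀ i → i ≤ n → f i ≡ g i) → Σ₀ n f ≡ Σ₀ n g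
Σ₀-cong zero    f≡g = f≡g 0 z≤n
Σ₀-cong (suc n) f≡g = cong₂ _+_ (Σ₀-cong n λ i i≤n → f≡g i (ℕP.m≤n⇒m≤1+n i≤n)) (f≡g (suc n) ℕP.≤-refl)

Σ₀-mono-≤ : ∀ n {f g : ℕ → ℚ} → (∀ i → i ≤ n → f i ≤ℚ g i) → Σ₀ n f ≤ℚ Σ₀ n g
Σ₀-mono-≤ zero    f≤g = f≤g 0 z≤n
Σ₀-mono-≤ (suc n) f≤g = ℚP.+-mono-≤ (Σ₀-mono-≤ n λ i i≤n → f≤g i (ℕP.m≤n⇒m≤1+n i≤n)) (f≤g (suc n) ℕP.≤-refl)

Σ₀-nonNeg : ∀ n {f : ℕ → ℚ} → (∀ i → i ≤ n → 0ℚ ≤ℚ f i) → 0ℚ ≤ℚ Σ₀ n f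
Σ₀-nonNeg zero    0≤f = 0≤f 0 z≤n
Σ₀-nonNeg (suc n) 0≤f = +-nonNeg (Σ₀-nonNeg n λ i i≤n → 0≤f i (ℕP.m≤n⇒m≤1+n i≤n)) (0≤f (suc n) ℕP.≤-refl)

Σ₀-extend-≤ : ∀ {n N} {f : ℕ → ℚ} → n ≤ N → (∀ i → i ≤ N → 0ℚ ≤ℚ f i) → Σ₀ n f ≤ℚ Σ₀ N f
Σ₀-extend-≤ {N = zero}  z≤n _ = ℚP.≤-refl
Σ₀-extend-≤ {N = suc N} n≤N 0≤f with ℕP.m≤n⇒m<n∨m≡n n≤N
... | inj₂ refl        = ℚP.≤-refl
... | inj₁ (s≤s n≤N′) =
  ℚP.≤-trans (Σ₀-extend-≤ n≤N′ λ i i≤N → 0≤f i (ℕP.m≤n⇒m≤1+n i≤N)) (p≤p+q (0≤f (suc N) ℕP.≤-refl))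

Σ₀-distribˡ : ∀ n a (f : ℕ → ℚ) → Σ₀ n (λ i → a * f i) ≡ a * Σ₀ n f
Σ₀-distribˡ zero    a f = refl
Σ₀-distribˡ (suc n) a f =
  trans (cong (_+ a * f (suc n)) (Σ₀-distribˡ n a f)) (sym (ℚP.*-distribˡ-+ a (Σ₀ n f) (f (suc n))))

Σ₀-distribʳ : ∀ n a (f : ℕ → ℚ) → Σ₀ n (λ i → f i * a) ≡ Σ₀ n f * a
Σ₀-distribʳ zero    a f = refl
Σ₀-distribʳ (suc n) a f =
  trans (cong (_+ f (suc n) * a) (Σ₀-distribʳ n a f)) (sym (ℚP.*-distribʳ-+ a (Σ₀ n f) (f (suc n))))

Σ₀-+ : ∀ n (f g : ℕ → ℚ) → Σ₀ n (λ i → f i + g i) ≡ Σ₀ n f + Σ₀ n g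
Σ₀-+ zero    f g = refl
Σ₀-+ (suc n) f g = trans (cong (_+ (f (suc n) + g (suc n))) (Σ₀-+ n f g))
  (solve 4 (λ a b c d → (a :+ b) :+ (c :+ d) := (a :+ c) :+ (b :+ d)) refl (Σ₀ n f) (Σ₀ n g) (f (suc n)) (g (suc n)))

Σ₀-suc : ∀ n (f : ℕ → ℚ) → Σ₀ (suc n) f ≡ f 0 + Σ₀ n (λ i → f (suc i))
Σ₀-suc zero    f = refl
Σ₀-suc (suc n) f = trans (cong (_+ f (suc (suc n))) (Σ₀-suc n f)) (ℚP.+-assoc (f 0) _ _)

Step : Set
Step = ℕ → (ℕ → ℚ) → ℚ

-- The memo table of cov is private to Defs; it is recovered as the
-- function to which cov step (suc m) applies step.
private
  cov-suc : ∀ step m → Σ (ℕ → ℚ) λ t → cov step (suc m) ≡ (if m <ᵇ m then t (suc m) else step (suc m) t)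
  cov-suc step m = _ , refl

  table : Step → ℕ → ℕ → ℚ
  table step m = proj₁ (cov-suc step m)

  <ᵇ-irrefl : ∀ m → (m <ᵇ m) ≡ false
  <ᵇ-irrefl zero    = refl
  <ᵇ-irrefl (suc m) = <ᵇ-irrefl m

  ≤⇒<ᵇsuc : ∀ {i m} → i ≤ m → (i <ᵇ suc m) ≡ true
  ≤⇒<ᵇsuc z≤n       = refl
  ≤⇒<ᵇsuc (s≤s i≤m) = ≤⇒<ᵇsuc i≤m

  table-cov : ∀ step m i → i ≤ m → table step m i ≡ cov step i
  table-cov step zero    zero z≤n = refl
  table-cov step (suc m) i i≤m with ℕP.m≤n⇒m<n∨m≡n i≤m
  ... | inj₂ refl       = refl
  ... | inj₁ (s≤s i≤m′) rewrite ≤⇒<ᵇsuc {i} {m} i≤m′ = table-cov step m i i≤m′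

cov-unfold : ∀ step n → (∀ f → (∀ i → i < n → f i ≡ cov step i) → step n f ≡ step n (cov step)) →
             cov step n ≡ step n (cov step)
cov-unfold step zero    step-cong = step-cong _ λ _ ()
cov-unfold step (suc m) step-cong rewrite proj₂ (cov-suc step m) | <ᵇ-irrefl m =
  step-cong (table step m) λ i i<1+m → table-cov step m i (ℕP.≤-pred i<1+m)

bConv : ℕ → ℚ
bConv k = Σ₁ (k ℕ.∸ 1) λ t → ι (t ℕ.* (k ℕ.∸ t)) * b t * b (k ℕ.∸ t)

bcConv : ℕ → ℚ
bcConv k = Σ₁ (k ℕ.∸ 1) λ t → ι (t ℕ.* (3 ℕ.* k ℕ.∸ 3 ℕ.* t ℕ.∸ 1)) * b t * c (k ℕ.∸ t)

private
  b-unfold : ∀ j → b (suc (suc j)) ≡ bStep (suc (suc j)) b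
  b-unfold j = cov-unfold bStep (suc (suc j)) λ f f≡b →
    cong₂ (λ x y → (ι (3 ℕ.* k ℕ.* (k ℕ.+ 1)) * x + ι 3 * y) * ((+ 1) / (2 ℕ.* suc k)))
      (f≡b k ℕP.≤-refl)
      (Σ₁-cong j λ t _ t≤j → cong₂ (λ u v → ι (t ℕ.* (k ℕ.∸ t)) * u * v)
        (f≡b t (s≤s (ℕP.m≤n⇒m≤1+n t≤j))) (f≡b (k ℕ.∸ t) (s≤s (ℕP.m∸n≤m k t))))
    where k = suc j

  c-unfold : ∀ j → c (suc (suc j)) ≡ cStep (suc (suc j)) c
  c-unfold j = cov-unfold cStep (suc (suc j)) λ f f≡c →
    cong₂ (λ x y → (ι (8 ℕ.* (k ℕ.+ 1)) * b (k ℕ.+ 1) + ι (3 ℕ.* k) * b k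
                      + ι ((3 ℕ.* k ℕ.+ 2) ℕ.* (3 ℕ.* k ℕ.∸ 1)) * x + ι 6 * y)
                   * ((+ 1) / (2 ℕ.* (3 ℕ.* k ℕ.+ 2))))
      (f≡c k ℕP.≤-refl)
      (Σ₁-cong j λ t _ _ → cong (λ v → ι (t ℕ.* (3 ℕ.* k ℕ.∸ 3 ℕ.* t ℕ.∸ 1)) * b t * v)
        (f≡c (k ℕ.∸ t) (s≤s (ℕP.m∸n≤m k t))))
    where k = suc j

b-rec : ∀ k → 1 ≤ k → ι 2 * (ι k + 1ℚ) * b (suc k) ≡ ι 3 * ι k * (ι k + 1ℚ) * b k + ι 3 * bConv k
b-rec (suc j) _ = begin
  ι 2 * (ι k + 1ℚ) * b (suc k)
    ≡⟨ cong₂ _*_ (sym (trans (ι-* 2 (suc k)) (cong (ι 2 *_) (ι-suc k)))) (b-unfold j) ⟩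
  ι (2 ℕ.* suc k) * (E * ((+ 1) / (2 ℕ.* suc k)))
    ≡⟨ ι-cancel-/ (2 ℕ.* suc k) E ⟩
  E
    ≡⟨ cong (λ x → x * b k + ι 3 * bConv k) (trans (ι-* (3 ℕ.* k) (k ℕ.+ 1)) (cong₂ _*_ (ι-* 3 k) (ι-+ k 1))) ⟩
  ι 3 * ι k * (ι k + 1ℚ) * b k + ι 3 * bConv k ∎
  where
  open ≡-Reasoning
  k = suc j
  E = ι (3 ℕ.* k ℕ.* (k ℕ.+ 1)) * b k + ι 3 * bConv k

c-rec : ∀ k → 1 ≤ k →
  ι 2 * (ι 3 * ι k + ι 2) * c (suc k)
    ≡ ι 8 * (ι k + 1ℚ) * b (suc k) + ι 3 * ι k * b k + (ι 3 * ι k + ι 2) * (ι 3 * ι k - 1ℚ) * c k + ι 6 * bcConv k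
c-rec (suc j) _ = begin
  ι 2 * (ι 3 * ι k + ι 2) * c (suc k)
    ≡⟨ cong₂ _*_ (sym (trans (ι-* 2 (3 ℕ.* k ℕ.+ 2)) (cong (ι 2 *_) ι[3k+2]))) (c-unfold j) ⟩
  ι (2 ℕ.* (3 ℕ.* k ℕ.+ 2)) * (E * ((+ 1) / (2 ℕ.* (3 ℕ.* k ℕ.+ 2))))
    ≡⟨ ι-cancel-/ (2 ℕ.* (3 ℕ.* k ℕ.+ 2)) E ⟩
  E
    ≡⟨ cong (_+ ι 6 * bcConv k) (cong₂ _+_
         (cong₂ _+_ (cong₂ _*_ (trans (ι-* 8 (k ℕ.+ 1)) (cong (ι 8 *_) (ι-+ k 1))) (cong b (ℕP.+-comm k 1)))
                    (cong (_* b k) (ι-* 3 k)))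
         (cong (_* c k) (trans (ι-* (3 ℕ.* k ℕ.+ 2) (3 ℕ.* k ℕ.∸ 1)) (cong₂ _*_ ι[3k+2] ι[3k-1])))) ⟩
  ι 8 * (ι k + 1ℚ) * b (suc k) + ι 3 * ι k * b k + (ι 3 * ι k + ι 2) * (ι 3 * ι k - 1ℚ) * c k + ι 6 * bcConv k ∎
  where
  open ≡-Reasoning
  k = suc j
  E = ι (8 ℕ.* (k ℕ.+ 1)) * b (k ℕ.+ 1) + ι (3 ℕ.* k) * b k
      + ι ((3 ℕ.* k ℕ.+ 2) ℕ.* (3 ℕ.* k ℕ.∸ 1)) * c k + ι 6 * bcConv k
  ι[3k+2] : ι (3 ℕ.* k ℕ.+ 2) ≡ ι 3 * ι k + ι 2
  ι[3k+2] = trans (ι-+ (3 ℕ.* k) 2) (cong (_+ ι 2) (ι-* 3 k))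
  ι[3k-1] : ι (3 ℕ.* k ℕ.∸ 1) ≡ ι 3 * ι k - 1ℚ
  ι[3k-1] = trans (ι-∸ {3 ℕ.* k} {1} (s≤s z≤n)) (cong (_- 1ℚ) (ι-* 3 k))

b-nonNeg : ∀ k → 0ℚ ≤ℚ b k
b-nonNeg = <-rec _ step
  where
  step : ∀ k → (∀ {i} → i < k → 0ℚ ≤ℚ b i) → 0ℚ ≤ℚ b k
  step zero          _  = ℚP.≤-refl
  step (suc zero)    _  = ℚP.≤ᵇ⇒≤ tt
  step (suc (suc j)) ih = subst (0ℚ ≤ℚ_) (sym (b-unfold j)) (*-nonNeg
    (+-nonNeg (*-nonNeg (ι-nonNeg (3 ℕ.* k ℕ.* (k ℕ.+ 1))) (ih ℕP.≤-refl))
              (*-nonNeg (ι-nonNeg 3) (Σ₁-nonNeg j λ t _ t≤j →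
                *-nonNeg (*-nonNeg (ι-nonNeg (t ℕ.* (k ℕ.∸ t))) (ih (s≤s (ℕP.m≤n⇒m≤1+n t≤j))))
                         (ih (s≤s (ℕP.m∸n≤m k t))))))
    (/-nonNeg 1 (2 ℕ.* suc k)))
    where k = suc j

bConv-nonNeg : ∀ k → 0ℚ ≤ℚ bConv k
bConv-nonNeg k = Σ₁-nonNeg (k ℕ.∸ 1) λ t _ _ →
  *-nonNeg (*-nonNeg (ι-nonNeg (t ℕ.* (k ℕ.∸ t))) (b-nonNeg t)) (b-nonNeg (k ℕ.∸ t))

-- α = c₁ / b₁, so the induction in c-lower is tight at k = 1.
α : ℚ
α = (+ 19) / 5

α-nonNeg : 0ℚ ≤ℚ α
α-nonNeg = /-nonNeg 19 5

1≤⇒pos : ∀ {p} → 1ℚ ≤ℚ p → Positive p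
1≤⇒pos 1≤p = ℚ.positive (ℚP.<-≤-trans (ℚP.positive⁻¹ 1ℚ) 1≤p)

-- With D₁ B′ = R_B and D₂ C′ = R_C the two recurrences, D₁ D₂ (C′ - α B′) equals a
-- combination W of B, X, C - α B and Y - 2 α X whose coefficients are polynomials
-- in K - 1 with nonnegative coefficients.
private
  module α-Certificate (K B X C Y : ℚ) where
    J  = K - 1ℚ
    D₁ = ι 2 * (K + 1ℚ)
    D₂ = ι 2 * (ι 3 * K + ι 2)
    PB = (J + ι 2) * (ι 24 * J * J + (+ 276) / 5 * J + ι 16)
    PX = (+ 234) / 5 * J + (+ 582) / 5
    PC = ι 2 * (J + ι 2) * (ι 3 * J + ι 5) * (ι 3 * J + ι 2)
    PY = ι 12 * (J + ι 2)
    W  = PB * B + PX * X + PC * (C - α * B) + PY * (Y - ι 2 * α * X)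
    R_B = ι 3 * K * (K + 1ℚ) * B + ι 3 * X
    R_C : ℚ → ℚ
    R_C B′ = ι 8 * (K + 1ℚ) * B′ + ι 3 * K * B + (ι 3 * K + ι 2) * (ι 3 * K - 1ℚ) * C + ι 6 * Y

    identity : ∀ B′ C′ →
      D₁ * D₂ * (C′ - α * B′) ≡ W + D₁ * (D₂ * C′ - R_C B′) + (ι 8 * (K + 1ℚ) - α * D₂) * (D₁ * B′ - R_B)
    identity = solve 7 (λ K B X C Y B′ C′ →
      let J  = K :- con 1ℚ
          D₁ = con (ι 2) :* (K :+ con 1ℚ)
          D₂ = con (ι 2) :* (con (ι 3) :* K :+ con (ι 2))
          PB = (J :+ con (ι 2)) :* (con (ι 24) :* J :* J :+ con ((+ 276) / 5) :* J :+ con (ι 16))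
          PX = con ((+ 234) / 5) :* J :+ con ((+ 582) / 5)
          PC = con (ι 2) :* (J :+ con (ι 2)) :* (con (ι 3) :* J :+ con (ι 5)) :* (con (ι 3) :* J :+ con (ι 2))
          PY = con (ι 12) :* (J :+ con (ι 2))
          R_B = con (ι 3) :* K :* (K :+ con 1ℚ) :* B :+ con (ι 3) :* X
          R_C = con (ι 8) :* (K :+ con 1ℚ) :* B′ :+ con (ι 3) :* K :* B
                :+ (con (ι 3) :* K :+ con (ι 2)) :* (con (ι 3) :* K :- con 1ℚ) :* C :+ con (ι 6) :* Y
      in D₁ :* D₂ :* (C′ :- con α :* B′)
         := PB :* B :+ PX :* X :+ PC :* (C :- con α :* B) :+ PY :* (Y :- con (ι 2) :* con α :* X)
            :+ D₁ :* (D₂ :* C′ :- R_C) :+ (con (ι 8) :* (K :+ con 1ℚ) :- con α :* D₂) :* (D₁ :* B′ :- R_B))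
      refl K B X C Y

    W-nonNeg : 1ℚ ≤ℚ K → 0ℚ ≤ℚ B → 0ℚ ≤ℚ X → α * B ≤ℚ C → ι 2 * α * X ≤ℚ Y → 0ℚ ≤ℚ W
    W-nonNeg 1≤K 0≤B 0≤X αB≤C 2αX≤Y = +-nonNeg (+-nonNeg (+-nonNeg
      (*-nonNeg (*-nonNeg 0≤J+2 (+-nonNeg (+-nonNeg (*-nonNeg (*-nonNeg (ι-nonNeg 24) 0≤J) 0≤J)
                                                    (*-nonNeg (/-nonNeg 276 5) 0≤J)) (ι-nonNeg 16))) 0≤B)
      (*-nonNeg (+-nonNeg (*-nonNeg (/-nonNeg 234 5) 0≤J) (/-nonNeg 582 5)) 0≤X))
      (*-nonNeg (*-nonNeg (*-nonNeg (*-nonNeg (ι-nonNeg 2) 0≤J+2) (0≤3J+ 5)) (0≤3J+ 2)) (p≤q⇒0≤q-p αB≤C)))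
      (*-nonNeg (*-nonNeg (ι-nonNeg 12) 0≤J+2) (p≤q⇒0≤q-p 2αX≤Y))
      where
      0≤J : 0ℚ ≤ℚ J
      0≤J = p≤q⇒0≤q-p 1≤K
      0≤J+2 : 0ℚ ≤ℚ J + ι 2
      0≤J+2 = +-nonNeg 0≤J (ι-nonNeg 2)
      0≤3J+_ : ∀ n → 0ℚ ≤ℚ ι 3 * J + ι n
      0≤3J+ n = +-nonNeg (*-nonNeg (ι-nonNeg 3) 0≤J) (ι-nonNeg n)

    D-pos : 1ℚ ≤ℚ K → Positive (D₁ * D₂)
    D-pos 1≤K = ℚP.pos*pos⇒pos D₁ {{D₁-pos}} D₂ {{D₂-pos}}
      where
      instance
        K-pos : Positive K
        K-pos = 1≤⇒pos 1≤K
        ι2-pos : Positive (ι 2)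
        ι2-pos = ι-pos 1
        ι3-pos : Positive (ι 3)
        ι3-pos = ι-pos 2
      D₁-pos : Positive D₁
      D₁-pos = ℚP.pos*pos⇒pos (ι 2) (K + 1ℚ) {{ℚP.pos+pos⇒pos K 1ℚ}}
      D₂-pos : Positive D₂
      D₂-pos = ℚP.pos*pos⇒pos (ι 2) (ι 3 * K + ι 2)
        {{ℚP.pos+pos⇒pos (ι 3 * K) {{ℚP.pos*pos⇒pos (ι 3) K}} (ι 2)}}

α-step : ∀ {K B X C Y B′ C′} → 1ℚ ≤ℚ K → 0ℚ ≤ℚ B → 0ℚ ≤ℚ X → α * B ≤ℚ C → ι 2 * α * X ≤ℚ Y →
  ι 2 * (K + 1ℚ) * B′ ≡ ι 3 * K * (K + 1ℚ) * B + ι 3 * X →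
  ι 2 * (ι 3 * K + ι 2) * C′ ≡ ι 8 * (K + 1ℚ) * B′ + ι 3 * K * B + (ι 3 * K + ι 2) * (ι 3 * K - 1ℚ) * C + ι 6 * Y →
  α * B′ ≤ℚ C′
α-step {K} {B} {X} {C} {Y} {B′} {C′} 1≤K 0≤B 0≤X αB≤C 2αX≤Y B′-rec C′-rec =
  0≤q-p⇒p≤q (ℚP.*-cancelˡ-≤-pos (D₁ * D₂) {{D-pos 1≤K}}
    (subst₂ _≤ℚ_ (sym (ℚP.*-zeroʳ (D₁ * D₂))) (sym D[C′-αB′]≡W) (W-nonNeg 1≤K 0≤B 0≤X αB≤C 2αX≤Y)))
  where
  open α-Certificate K B X C Y
  x≡y⇒x-y≡0 : ∀ {x y} → x ≡ y → x - y ≡ 0ℚ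
  x≡y⇒x-y≡0 {x} refl = ℚP.+-inverseʳ x
  D[C′-αB′]≡W : D₁ * D₂ * (C′ - α * B′) ≡ W
  D[C′-αB′]≡W = begin
    D₁ * D₂ * (C′ - α * B′)
      ≡⟨ identity B′ C′ ⟩
    W + D₁ * (D₂ * C′ - R_C B′) + (ι 8 * (K + 1ℚ) - α * D₂) * (D₁ * B′ - R_B)
      ≡⟨ cong₂ (λ u v → W + D₁ * u + (ι 8 * (K + 1ℚ) - α * D₂) * v) (x≡y⇒x-y≡0 C′-rec) (x≡y⇒x-y≡0 B′-rec) ⟩
    W + D₁ * 0ℚ + (ι 8 * (K + 1ℚ) - α * D₂) * 0ℚ
      ≡⟨ solve 3 (λ w d e → w :+ d :* con 0ℚ :+ e :* con 0ℚ := w) refl W D₁ (ι 8 * (K + 1ℚ) - α * D₂) ⟩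
    W ∎
    where open ≡-Reasoning

bcConv-lower : ∀ k → 1 ≤ k → (∀ {i} → 1 ≤ i → i < k → α * b i ≤ℚ c i) → ι 2 * α * bConv k ≤ℚ bcConv k
bcConv-lower (suc j) _ c-lower-below = begin
  ι 2 * α * bConv k
    ≡⟨ sym (Σ₁-distribˡ j (ι 2 * α) _) ⟩
  Σ₁ j (λ t → ι 2 * α * (ι (t ℕ.* (k ℕ.∸ t)) * b t * b (k ℕ.∸ t)))
    ≤⟨ Σ₁-mono-≤ j term-≤ ⟩
  bcConv k ∎
  where
  open ℚP.≤-Reasoning
  k = suc j
  term-≤ : ∀ t → 1 ≤ t → t ≤ j →
    ι 2 * α * (ι (t ℕ.* (k ℕ.∸ t)) * b t * b (k ℕ.∸ t)) ≤ℚ ι (t ℕ.* (3 ℕ.* k ℕ.∸ 3 ℕ.* t ℕ.∸ 1)) * b t * c (k ℕ.∸ t)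
  term-≤ t@(suc t′) _ t≤j = begin
    ι 2 * α * (ι m * b t * b s)
      ≡⟨ solve 5 (λ i a x y z → i :* a :* (x :* y :* z) := i :* x :* y :* (a :* z)) refl
           (ι 2) α (ι m) (b t) (b s) ⟩
    ι 2 * ι m * b t * (α * b s)
      ≡⟨ cong (λ x → x * b t * (α * b s)) (sym (ι-* 2 m)) ⟩
    ι (2 ℕ.* m) * b t * (α * b s)
      ≤⟨ *-mono-≤-0≤ (*-nonNeg (ι-nonNeg m′) (b-nonNeg t)) (*-nonNeg α-nonNeg (b-nonNeg s))
           (*-monoʳ-≤-0≤ (b-nonNeg t) (ι-mono-≤ (2t[k∸t]≤t[3k∸3t∸1] (s≤s t≤j))))
           (c-lower-below (ℕP.m<n⇒0<n∸m (s≤s t≤j)) (s≤s (ℕP.m∸n≤m j t′))) ⟩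
    ι m′ * b t * c s ∎
    where
    s  = k ℕ.∸ t
    m  = t ℕ.* s
    m′ = t ℕ.* (3 ℕ.* k ℕ.∸ 3 ℕ.* t ℕ.∸ 1)

c-lower : ∀ k → 1 ≤ k → α * b k ≤ℚ c k
c-lower = <-rec _ step
  where
  step : ∀ k → (∀ {i} → i < k → 1 ≤ i → α * b i ≤ℚ c i) → 1 ≤ k → α * b k ≤ℚ c k
  step (suc zero)    _  _ = ℚP.≤ᵇ⇒≤ tt
  step (suc (suc j)) ih _ =
    α-step (ι-mono-≤ {1} {k} (s≤s z≤n)) (b-nonNeg k) (bConv-nonNeg k) (ih ℕP.≤-refl (s≤s z≤n))
           (bcConv-lower k (s≤s z≤n) λ 1≤i i<k → ih (ℕP.m<n⇒m<1+n i<k) 1≤i)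
           (b-rec k (s≤s z≤n)) (c-rec k (s≤s z≤n))
    where k = suc j

c≤c′ : ∀ k → 2 ≤ k → c k ≤ℚ c′ k
c≤c′ (suc zero)    (s≤s ())
c≤c′ (suc (suc j)) _ = p≤p+q (*-nonNeg (*-nonNeg (/-nonNeg 3 2) (ι-nonNeg (suc j))) (b-nonNeg (suc j)))

r : PS
r = inv₁ oneMinusT

private
  r-cov : Σ Step λ step → r ≡ cov step
  r-cov = _ , refl

  suc∸<suc : ∀ m i → 1 ≤ i → suc m ℕ.∸ i < suc m
  suc∸<suc m (suc i) _ = s≤s (ℕP.m∸n≤m m i)

-- 1/(1 - T) = 1 + T/(1 - T)
r-rec : ∀ m → r (suc m) ≡ Σ₁ (suc m) (λ i → Tser i * r (suc m ℕ.∸ i))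
r-rec m = begin
  r (suc m)
    ≡⟨ cov-unfold (proj₁ r-cov) (suc m) (λ f f≡r → cong -_ (Σ₁-cong (suc m) λ i 1≤i _ →
         cong (oneMinusT i *_) (f≡r (suc m ℕ.∸ i) (suc∸<suc m i 1≤i)))) ⟩
  - Σ₁ (suc m) (λ i → oneMinusT i * r (suc m ℕ.∸ i))
    ≡⟨ cong -_ (Σ₁-cong (suc m) λ i 1≤i _ → [1-T]x≡-Tx i 1≤i (r (suc m ℕ.∸ i))) ⟩
  - Σ₁ (suc m) (λ i → - (Tser i * r (suc m ℕ.∸ i)))
    ≡⟨ cong -_ (Σ₁-neg (suc m) _) ⟩
  - - Σ₁ (suc m) (λ i → Tser i * r (suc m ℕ.∸ i))
    ≡⟨ solve 1 (λ x → :- (:- x) := x) refl _ ⟩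
  Σ₁ (suc m) (λ i → Tser i * r (suc m ℕ.∸ i)) ∎
  where
  open ≡-Reasoning
  [1-T]x≡-Tx : ∀ i → 1 ≤ i → ∀ x → oneMinusT i * x ≡ - (Tser i * x)
  [1-T]x≡-Tx (suc i) _ x = solve 2 (λ t x → (con 0ℚ :- t) :* x := :- (t :* x)) refl (Tser (suc i)) x

T-nonNeg : ∀ i → 0ℚ ≤ℚ Tser i
T-nonNeg zero    = ℚP.≤-refl
T-nonNeg (suc m) = /-nonNeg (suc m ℕ.^ m) (suc m !) {{suc m ℕP.!≢0}}

r-nonNeg : ∀ n → 0ℚ ≤ℚ r n
r-nonNeg = <-rec _ step
  where
  step : ∀ n → (∀ {i} → i < n → 0ℚ ≤ℚ r i) → 0ℚ ≤ℚ r n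
  step zero    _  = ℚP.≤ᵇ⇒≤ tt
  step (suc m) ih = subst (0ℚ ≤ℚ_) (sym (r-rec m))
    (Σ₁-nonNeg (suc m) λ i 1≤i _ → *-nonNeg (T-nonNeg i) (ih (suc∸<suc m i 1≤i)))

r-mono : ∀ m → r m ≤ℚ r (suc m)
r-mono m = subst₂ _≤ℚ_ (ℚP.*-identityˡ (r m)) (sym (r-rec m))
  (Σ₁-head-≤ m λ i _ _ → *-nonNeg (T-nonNeg i) (r-nonNeg (suc m ℕ.∸ i)))

r≤ι*r-suc : ∀ n → r n ≤ℚ ι (suc n) * r (suc n)
r≤ι*r-suc n = ℚP.≤-trans (r-mono n)
  (subst (r (suc n) ≤ℚ_) r+nr≡[n+1]r (p≤p+q (*-nonNeg (ι-nonNeg n) (r-nonNeg (suc n)))))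
  where
  r+nr≡[n+1]r : r (suc n) + ι n * r (suc n) ≡ ι (suc n) * r (suc n)
  r+nr≡[n+1]r = trans (solve 2 (λ x y → x :+ y :* x := (y :+ con 1ℚ) :* x) refl (r (suc n)) (ι n))
                      (cong (_* r (suc n)) (sym (ι-suc n)))

T≤4^ : ∀ m → Tser (suc m) ≤ℚ ι 4 ^ m
T≤4^ m = subst (Tser (suc m) ≤ℚ_) (ι-^ 4 m)
  (n/d≤m/e (suc m ℕ.^ m) (suc m !) (4 ℕ.^ m) 1 {{suc m ℕP.!≢0}}
     (subst (_≤ 4 ℕ.^ m ℕ.* suc m !) (sym (ℕP.*-identityʳ _)) ([1+m]^m≤4^m*[1+m]! m)))

Σ₁-geometric : ∀ x N l → l ≤ N →
  Σ₁ l (λ i → x ^ (i ℕ.∸ 1) * (x + 1ℚ) ^ (N ℕ.∸ i)) + x ^ l * (x + 1ℚ) ^ (N ℕ.∸ l) ≡ (x + 1ℚ) ^ N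
Σ₁-geometric x N zero    _   = solve 1 (λ y → con 0ℚ :+ con 1ℚ :* y := y) refl ((x + 1ℚ) ^ N)
Σ₁-geometric x N (suc l) l<N = begin
  Σ₁ l f + f (suc l) + x ^ suc l * y ^ (N ℕ.∸ suc l)
    ≡⟨ solve 4 (λ x s p q → s :+ p :* q :+ x :* p :* q := s :+ p :* ((x :+ con 1ℚ) :* q)) refl
         x (Σ₁ l f) (x ^ l) (y ^ (N ℕ.∸ suc l)) ⟩
  Σ₁ l f + x ^ l * y ^ suc (N ℕ.∸ suc l)
    ≡⟨ cong (λ e → Σ₁ l f + x ^ l * y ^ e) (sym (ℕP.+-∸-assoc 1 l<N)) ⟩
  Σ₁ l f + x ^ l * y ^ (N ℕ.∸ l)
    ≡⟨ Σ₁-geometric x N l (ℕP.<⇒≤ l<N) ⟩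
  y ^ N ∎
  where
  open ≡-Reasoning
  y = x + 1ℚ
  f = λ i → x ^ (i ℕ.∸ 1) * y ^ (N ℕ.∸ i)

r≤5^ : ∀ n → r n ≤ℚ ι 5 ^ n
r≤5^ = <-rec _ step
  where
  step : ∀ n → (∀ {i} → i < n → r i ≤ℚ ι 5 ^ i) → r n ≤ℚ ι 5 ^ n
  step zero    _  = ℚP.≤-refl
  step (suc m) ih = begin
    r (suc m)
      ≡⟨ r-rec m ⟩
    Σ₁ (suc m) (λ i → Tser i * r (suc m ℕ.∸ i))
      ≤⟨ Σ₁-mono-≤ (suc m) term-≤ ⟩
    Σ₁ (suc m) G
      ≤⟨ p≤p+q (*-nonNeg (^-nonNeg (ι-nonNeg 4) (suc m)) (^-nonNeg (ι-nonNeg 5) (m ℕ.∸ m))) ⟩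
    Σ₁ (suc m) G + ι 4 ^ suc m * ι 5 ^ (suc m ℕ.∸ suc m)
      ≡⟨ Σ₁-geometric (ι 4) (suc m) (suc m) ℕP.≤-refl ⟩
    ι 5 ^ suc m ∎
    where
    open ℚP.≤-Reasoning
    G = λ i → ι 4 ^ (i ℕ.∸ 1) * ι 5 ^ (suc m ℕ.∸ i)
    term-≤ : ∀ i → 1 ≤ i → i ≤ suc m → Tser i * r (suc m ℕ.∸ i) ≤ℚ G i
    term-≤ i@(suc i′) 1≤i _ =
      *-mono-≤-0≤ (^-nonNeg (ι-nonNeg 4) i′) (r-nonNeg (suc m ℕ.∸ i)) (T≤4^ i′) (ih (suc∸<suc m i 1≤i))

invPow-nonNeg : ∀ M n → 0ℚ ≤ℚ invPow M n
invPow-nonNeg zero    zero    = ℚP.≤ᵇ⇒≤ tt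
invPow-nonNeg zero    (suc n) = ℚP.≤-refl
invPow-nonNeg (suc M) n       = Σ₀-nonNeg n λ i _ → *-nonNeg (r-nonNeg i) (invPow-nonNeg M (n ℕ.∸ i))

⊛-leibniz : ∀ f g n → ι n * (f ⊛ g) n ≡ ((λ i → ι i * f i) ⊛ g) n + (f ⊛ (λ i → ι i * g i)) n
⊛-leibniz f g n = begin
  ι n * Σ₀ n (λ i → f i * g (n ℕ.∸ i))
    ≡⟨ sym (Σ₀-distribˡ n (ι n) _) ⟩
  Σ₀ n (λ i → ι n * (f i * g (n ℕ.∸ i)))
    ≡⟨ Σ₀-cong n split ⟩
  Σ₀ n (λ i → ι i * f i * g (n ℕ.∸ i) + f i * (ι (n ℕ.∸ i) * g (n ℕ.∸ i)))
    ≡⟨ Σ₀-+ n _ _ ⟩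
  ((λ i → ι i * f i) ⊛ g) n + (f ⊛ (λ i → ι i * g i)) n ∎
  where
  open ≡-Reasoning
  split : ∀ i → i ≤ n → ι n * (f i * g (n ℕ.∸ i)) ≡ ι i * f i * g (n ℕ.∸ i) + f i * (ι (n ℕ.∸ i) * g (n ℕ.∸ i))
  split i i≤n = trans
    (cong (_* (f i * g (n ℕ.∸ i))) (trans (cong ι (sym (ℕP.m+[n∸m]≡n i≤n))) (ι-+ i (n ℕ.∸ i))))
    (solve 4 (λ a e x y → (a :+ e) :* (x :* y) := a :* x :* y :+ x :* (e :* y)) refl
       (ι i) (ι (n ℕ.∸ i)) (f i) (g (n ℕ.∸ i)))

-- In the Leibniz rule for r ⊛ invPow M, the first sum dominates invPow (M + 1) n because
-- r i ≤ (i + 1) r (i + 1), and the second dominates M invPow (M + 1) n by induction.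
invPow-growth : ∀ M n → ι M * invPow M n ≤ℚ ι (suc n) * invPow M (suc n)
invPow-growth zero    n = ℚP.≤-reflexive (trans (ℚP.*-zeroˡ (invPow 0 n)) (sym (ℚP.*-zeroʳ (ι (suc n)))))
invPow-growth (suc M) n = begin
  ι (suc M) * S
    ≡⟨ trans (cong (_* S) (ι-suc M)) (solve 2 (λ s m → (m :+ con 1ℚ) :* s := s :+ m :* s) refl S (ι M)) ⟩
  S + ι M * S
    ≤⟨ ℚP.+-mono-≤ S≤ ιM*S≤ ⟩
  Σ₀ (suc n) H₁ + Σ₀ (suc n) H₂
    ≡⟨ sym (⊛-leibniz r A (suc n)) ⟩
  ι (suc n) * invPow (suc M) (suc n) ∎
  where
  open ℚP.≤-Reasoning
  A  = invPow M
  S  = invPow (suc M) n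
  H₁ = λ i → ι i * r i * A (suc n ℕ.∸ i)
  H₂ = λ i → r i * (ι (suc n ℕ.∸ i) * A (suc n ℕ.∸ i))
  S≤ : S ≤ℚ Σ₀ (suc n) H₁
  S≤ = begin
    S
      ≡⟨ sym (ℚP.+-identityˡ S) ⟩
    0ℚ + S
      ≤⟨ ℚP.+-mono-≤ (*-nonNeg (*-nonNeg (ι-nonNeg 0) (r-nonNeg 0)) (invPow-nonNeg M (suc n)))
                     (Σ₀-mono-≤ n λ i _ → *-monoʳ-≤-0≤ (invPow-nonNeg M (n ℕ.∸ i)) (r≤ι*r-suc i)) ⟩
    H₁ 0 + Σ₀ n (λ i → H₁ (suc i))
      ≡⟨ sym (Σ₀-suc n H₁) ⟩
    Σ₀ (suc n) H₁ ∎
  ιM*S≤ : ι M * S ≤ℚ Σ₀ (suc n) H₂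
  ιM*S≤ = begin
    ι M * S
      ≡⟨ sym (Σ₀-distribˡ n (ι M) _) ⟩
    Σ₀ n (λ i → ι M * (r i * A (n ℕ.∸ i)))
      ≤⟨ Σ₀-mono-≤ n term-≤ ⟩
    Σ₀ n H₂
      ≤⟨ p≤p+q (*-nonNeg (r-nonNeg (suc n)) (*-nonNeg (ι-nonNeg (n ℕ.∸ n)) (invPow-nonNeg M (n ℕ.∸ n)))) ⟩
    Σ₀ (suc n) H₂ ∎
    where
    term-≤ : ∀ i → i ≤ n → ι M * (r i * A (n ℕ.∸ i)) ≤ℚ H₂ i
    term-≤ i i≤n = subst₂ _≤ℚ_
      (solve 3 (λ m x y → x :* (m :* y) := m :* (x :* y)) refl (ι M) (r i) (A (n ℕ.∸ i)))
      (cong (λ e → r i * (ι e * A e)) (sym (ℕP.+-∸-assoc 1 i≤n)))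
      (*-monoˡ-≤-0≤ (r-nonNeg i) (invPow-growth M (n ℕ.∸ i)))

invPow-pred-≤ : ∀ M p θ → ι (suc p) ≤ℚ θ * ι (suc M) → invPow (suc M) p ≤ℚ θ * invPow (suc M) (suc p)
invPow-pred-≤ M p θ p+1≤θ[M+1] = ℚP.*-cancelˡ-≤-pos (ι (suc M)) {{ι-pos M}} (begin
  ι (suc M) * invPow (suc M) p
    ≤⟨ invPow-growth (suc M) p ⟩
  ι (suc p) * invPow (suc M) (suc p)
    ≤⟨ *-monoʳ-≤-0≤ (invPow-nonNeg (suc M) (suc p)) p+1≤θ[M+1] ⟩
  θ * ι (suc M) * invPow (suc M) (suc p)
    ≡⟨ solve 3 (λ t i x → t :* i :* x := i :* (t :* x)) refl θ (ι (suc M)) (invPow (suc M) (suc p)) ⟩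
  ι (suc M) * (θ * invPow (suc M) (suc p)) ∎)
  where open ℚP.≤-Reasoning

invPow-∸-≤ : ∀ M θ n → 0ℚ ≤ℚ θ → ι n ≤ℚ θ * ι (suc M) → ∀ j → j ≤ n →
             invPow (suc M) (n ℕ.∸ j) ≤ℚ θ ^ j * invPow (suc M) n
invPow-∸-≤ M θ n _   _        zero    _   = ℚP.≤-reflexive (sym (ℚP.*-identityˡ (invPow (suc M) n)))
invPow-∸-≤ M θ n 0≤θ n≤θ[M+1] (suc j) j<n = begin
  invPow (suc M) (n ℕ.∸ suc j)
    ≤⟨ invPow-pred-≤ M (n ℕ.∸ suc j) θ (ℚP.≤-trans (ι-mono-≤ n-j≤n) n≤θ[M+1]) ⟩
  θ * invPow (suc M) (suc (n ℕ.∸ suc j))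
    ≡⟨ cong (λ e → θ * invPow (suc M) e) (sym n∸j≡suc) ⟩
  θ * invPow (suc M) (n ℕ.∸ j)
    ≤⟨ *-monoˡ-≤-0≤ 0≤θ (invPow-∸-≤ M θ n 0≤θ n≤θ[M+1] j (ℕP.<⇒≤ j<n)) ⟩
  θ * (θ ^ j * invPow (suc M) n)
    ≡⟨ sym (ℚP.*-assoc θ (θ ^ j) (invPow (suc M) n)) ⟩
  θ ^ suc j * invPow (suc M) n ∎
  where
  open ℚP.≤-Reasoning
  n∸j≡suc : n ℕ.∸ j ≡ suc (n ℕ.∸ suc j)
  n∸j≡suc = ℕP.+-∸-assoc 1 j<n
  n-j≤n : suc (n ℕ.∸ suc j) ≤ n
  n-j≤n = subst (_≤ n) n∸j≡suc (ℕP.m∸n≤m n j)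

evalUpTo : PS → ℚ → ℕ → ℚ
evalUpTo f θ n = Σ₀ n λ j → f j * θ ^ j

evalUpTo-mono : ∀ f θ {n N} → (∀ j → 0ℚ ≤ℚ f j) → 0ℚ ≤ℚ θ → n ≤ N → evalUpTo f θ n ≤ℚ evalUpTo f θ N
evalUpTo-mono f θ 0≤f 0≤θ n≤N = Σ₀-extend-≤ n≤N λ j _ → *-nonNeg (0≤f j) (^-nonNeg 0≤θ j)

invPow-suc-≤ : ∀ M θ n → 0ℚ ≤ℚ θ → ι n ≤ℚ θ * ι (suc M) →
               invPow (suc (suc M)) n ≤ℚ evalUpTo r θ n * invPow (suc M) n
invPow-suc-≤ M θ n 0≤θ n≤θ[M+1] = begin
  Σ₀ n (λ j → r j * invPow (suc M) (n ℕ.∸ j))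
    ≤⟨ Σ₀-mono-≤ n (λ j j≤n → *-monoˡ-≤-0≤ (r-nonNeg j) (invPow-∸-≤ M θ n 0≤θ n≤θ[M+1] j j≤n)) ⟩
  Σ₀ n (λ j → r j * (θ ^ j * invPow (suc M) n))
    ≡⟨ Σ₀-cong n (λ j _ → sym (ℚP.*-assoc (r j) (θ ^ j) (invPow (suc M) n))) ⟩
  Σ₀ n (λ j → r j * θ ^ j * invPow (suc M) n)
    ≡⟨ Σ₀-distribʳ n (invPow (suc M) n) (λ j → r j * θ ^ j) ⟩
  evalUpTo r θ n * invPow (suc M) n ∎
  where open ℚP.≤-Reasoning

Σ₀-geometric : ∀ q n → Σ₀ n (q ^_) * (1ℚ - q) ≡ 1ℚ - q ^ suc n
Σ₀-geometric q zero    = solve 1 (λ q → con 1ℚ :* (con 1ℚ :- q) := con 1ℚ :- q :* con 1ℚ) refl q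
Σ₀-geometric q (suc n) = begin
  (Σ₀ n (q ^_) + q ^ suc n) * (1ℚ - q)
    ≡⟨ solve 3 (λ s p q → (s :+ p) :* (con 1ℚ :- q) := s :* (con 1ℚ :- q) :+ (p :- q :* p)) refl
         (Σ₀ n (q ^_)) (q ^ suc n) q ⟩
  Σ₀ n (q ^_) * (1ℚ - q) + (q ^ suc n - q ^ suc (suc n))
    ≡⟨ cong (_+ (q ^ suc n - q ^ suc (suc n))) (Σ₀-geometric q n) ⟩
  1ℚ - q ^ suc n + (q ^ suc n - q ^ suc (suc n))
    ≡⟨ solve 2 (λ p p′ → con 1ℚ :- p :+ (p :- p′) := con 1ℚ :- p′) refl (q ^ suc n) (q ^ suc (suc n)) ⟩
  1ℚ - q ^ suc (suc n) ∎
  where open ≡-Reasoning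

Σ₀-[5/7]^≤7/2 : ∀ n → Σ₀ n ((5 // 7) ^_) ≤ℚ (+ 7) / 2
Σ₀-[5/7]^≤7/2 n = begin
  Σ₀ n (q ^_)
    ≡⟨ solve 1 (λ s → s := s :* con (1ℚ - q) :* con ((+ 7) / 2)) refl (Σ₀ n (q ^_)) ⟩
  Σ₀ n (q ^_) * (1ℚ - q) * ((+ 7) / 2)
    ≡⟨ cong (_* ((+ 7) / 2)) (Σ₀-geometric q n) ⟩
  (1ℚ - q ^ suc n) * ((+ 7) / 2)
    ≤⟨ *-monoʳ-≤-0≤ {(+ 7) / 2} {1ℚ - q ^ suc n} {1ℚ} (/-nonNeg 7 2) 1-qⁿ⁺¹≤1 ⟩
  1ℚ * ((+ 7) / 2)
    ≡⟨ ℚP.*-identityˡ ((+ 7) / 2) ⟩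
  (+ 7) / 2 ∎
  where
  open ℚP.≤-Reasoning
  q = 5 // 7
  1-qⁿ⁺¹≤1 : 1ℚ - q ^ suc n ≤ℚ 1ℚ
  1-qⁿ⁺¹≤1 = 0≤q-p⇒p≤q (subst (0ℚ ≤ℚ_) (solve 1 (λ x → x := con 1ℚ :- (con 1ℚ :- x)) refl (q ^ suc n))
                                       (^-nonNeg (//-nonNeg 5 7) (suc n)))

evalUpTo-r-1/2 : evalUpTo r (1 // 2) 4 ≤ℚ α
evalUpTo-r-1/2 = ℚP.≤ᵇ⇒≤ tt

evalUpTo-r-5/14 : evalUpTo r (5 // 14) 7 ≤ℚ α
evalUpTo-r-5/14 = ℚP.≤ᵇ⇒≤ tt

evalUpTo-r-1/7 : ∀ n → evalUpTo r (1 // 7) n ≤ℚ α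
evalUpTo-r-1/7 n = begin
  evalUpTo r (1 // 7) n
    ≤⟨ Σ₀-mono-≤ n (λ j _ → *-monoʳ-≤-0≤ (^-nonNeg (//-nonNeg 1 7) j) (r≤5^ j)) ⟩
  Σ₀ n (λ j → ι 5 ^ j * (1 // 7) ^ j)
    ≡⟨ Σ₀-cong n (λ j _ → sym (^-distrib-* (ι 5) (1 // 7) j)) ⟩
  Σ₀ n ((5 // 7) ^_)
    ≤⟨ Σ₀-[5/7]^≤7/2 n ⟩
  (+ 7) / 2
    ≤⟨ ℚP.≤ᵇ⇒≤ tt ⟩
  α ∎
  where open ℚP.≤-Reasoning

invPow-suc≤ρ*invPow : ∀ M p d n ρ .{{_ : NonZero d}} → d ℕ.* n ≤ p ℕ.* suc M → evalUpTo r (p // d) n ≤ℚ ρ →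
                      invPow (suc (suc M)) n ≤ℚ ρ * invPow (suc M) n
invPow-suc≤ρ*invPow M p d n ρ dn≤p[M+1] eval≤ρ = ℚP.≤-trans
  (invPow-suc-≤ M (p // d) n (//-nonNeg p d) (ι≤//*ι p d dn≤p[M+1]))
  (*-monoʳ-≤-0≤ (invPow-nonNeg (suc M) n) eval≤ρ)

invPow-3k≤α*invPow-3k∸1 : ∀ k n → 3 ≤ k → BelowN₀ k n → invPow (3 ℕ.* k) n ≤ℚ α * invPow (3 ℕ.* k ℕ.∸ 1) n
invPow-3k≤α*invPow-3k∸1 k n 3≤k@(s≤s (s≤s (s≤s _))) hb with n ℕ.≤? 4 | n ℕ.≤? 7
... | yes n≤4 | _       = invPow-suc≤ρ*invPow (3 ℕ.* k ℕ.∸ 2) 1 2 n α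
  (n≤4⇒2n≤3k∸1 {k} 3≤k n≤4)
  (ℚP.≤-trans (evalUpTo-mono r (1 // 2) r-nonNeg (//-nonNeg 1 2) n≤4) evalUpTo-r-1/2)
... | no n≰4  | yes n≤7 = invPow-suc≤ρ*invPow (3 ℕ.* k ℕ.∸ 2) 5 14 n α
  (5≤n⇒14n≤5[3k∸1] {k} (ℕP.≰⇒> n≰4) (BelowN₀⇒n[n∸3]≤2k k n hb))
  (ℚP.≤-trans (evalUpTo-mono r (5 // 14) r-nonNeg (//-nonNeg 5 14) n≤7) evalUpTo-r-5/14)
... | no _    | no n≰7  = invPow-suc≤ρ*invPow (3 ℕ.* k ℕ.∸ 2) 1 7 n α
  (8≤n⇒7n≤3k∸1 {k} (ℕP.≰⇒> n≰7) (BelowN₀⇒n[n∸3]≤2k k n hb))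
  (evalUpTo-r-1/7 n)

b₂-invPow≤c′₂-invPow : ∀ n → n ≤ 4 → b 2 * invPow 6 n ≤ℚ c′ 2 * invPow 5 n
b₂-invPow≤c′₂-invPow 0 _ = ℚP.≤ᵇ⇒≤ tt
b₂-invPow≤c′₂-invPow 1 _ = ℚP.≤ᵇ⇒≤ tt
b₂-invPow≤c′₂-invPow 2 _ = ℚP.≤ᵇ⇒≤ tt
b₂-invPow≤c′₂-invPow 3 _ = ℚP.≤ᵇ⇒≤ tt
b₂-invPow≤c′₂-invPow 4 _ = ℚP.≤ᵇ⇒≤ tt
b₂-invPow≤c′₂-invPow (suc (suc (suc (suc (suc _))))) (s≤s (s≤s (s≤s (s≤s ()))))

b-invPow≤c′-invPow : ∀ k n → 2 ≤ k → BelowN₀ k n → b k * invPow (3 ℕ.* k) n ≤ℚ c′ k * invPow (3 ℕ.* k ℕ.∸ 1) n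
b-invPow≤c′-invPow (suc zero)             n (s≤s ()) _
b-invPow≤c′-invPow (suc (suc zero))       n _ hb = b₂-invPow≤c′₂-invPow n (BelowN₀-2⇒n≤4 n hb)
b-invPow≤c′-invPow k@(suc (suc (suc j))) n _ hb = begin
  b k * invPow (3 ℕ.* k) n
    ≤⟨ *-monoˡ-≤-0≤ (b-nonNeg k) (invPow-3k≤α*invPow-3k∸1 k n (s≤s (s≤s (s≤s z≤n))) hb) ⟩
  b k * (α * A)
    ≡⟨ solve 3 (λ x a y → x :* (a :* y) := a :* x :* y) refl (b k) α A ⟩
  α * b k * A
    ≤⟨ *-monoʳ-≤-0≤ (invPow-nonNeg (3 ℕ.* k ℕ.∸ 1) n) (c-lower k (s≤s z≤n)) ⟩
  c k * A
    ≤⟨ *-monoʳ-≤-0≤ (invPow-nonNeg (3 ℕ.* k ℕ.∸ 1) n) (c≤c′ k (s≤s (s≤s z≤n))) ⟩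
  c′ k * A ∎
  where
  open ℚP.≤-Reasoning
  A = invPow (3 ℕ.* k ℕ.∸ 1) n

Wser-nonNeg : ∀ k n → 0ℚ ≤ℚ Wser k n
Wser-nonNeg k n = /-nonNeg (g n k) (n !) {{n ℕP.!≢0}}

lemma27 : (k n : ℕ) → 2 ≤ k → BelowN₀ k n → 0ℚ ≤ℚ Lser k n
lemma27 k n 2≤k hb = subst (0ℚ ≤ℚ_) (solve 3 (λ w x y → w :+ (y :- x) := w :- x :+ y) refl W X Y)
  (+-nonNeg (Wser-nonNeg k n) (p≤q⇒0≤q-p (b-invPow≤c′-invPow k n 2≤k hb)))
  where
  W = Wser k n
  X = b k * invPow (3 ℕ.* k) n
  Y = c′ k * invPow (3 ℕ.* k ℕ.∸ 1) n
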